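{- Let $a\in\mathbb{N}$, $a\ge3$, $S=\langle a,a+1,a+2\rangle$, and let $r\in S\cap\llbracket 0,\mathscr{L}_a)\!)$. Let $\alpha,\gamma\in\operatorname{F}(r,S)$ with $\alpha\ne\gamma$, and set $\omega=(-1,2,-1)\in\mathbb{Z}^3$. Then: (1) $\alpha_1+\alpha_2+\alpha_3=\gamma_1+\gamma_2+\gamma_3$; (2) $\alpha_2+2\alpha_3=\gamma_2+2\gamma_3$; (3) $\alpha_1\ne\gamma_1$, $\alpha_2\ne\gamma_2$ and $\alpha_3\ne\gamma_3$; (4) if $\gamma_2>\alpha_2$, then $\gamma=\alpha+j\omega$ for some integer $j$ with $1\le j\le\min(\alpha_1,\alpha_3)$; if $\gamma_2<\alpha_2$, then $\alpha=\gamma+j\omega$ for some integer $j$ with $1\le j\le\min(\gamma_1,\gamma_3)$.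
   Context: $\mathbb{N}=\{0,1,2,\dots\}$. $S=\langle a,a+1,a+2\rangle=\{\alpha_1a+\alpha_2(a+1)+\alpha_3(a+2):\alpha_i\in\mathbb{N}\}$. $\operatorname{F}(r,S)=\{\alpha\in\mathbb{N}^3:\alpha_1a+\alpha_2(a+1)+\alpha_3(a+2)=r\}$. $\mathscr{L}_a=\lfloor a/2\rfloor (a+2)$ if $a$ is even, and $\mathscr{L}_a=(\lfloor a/2\rfloor+2)a$ if $a$ is odd. $\llbracket x,y)\!)=\{n\in\mathbb{Z}:x\le n<y\}$. -}

module Defs where

open import Data.Nat using (ℕ; _+_; _*_; _/_; _%_; _<_)
open import Data.Nat.Properties using ()
open import Data.Integer as ℤ using (ℤ; +_)
open import Data.Product using (_×_; _,_; ∃; Σ)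
open import Relation.Binary.PropositionalEquality using (_≡_)

ℕ³ : Set
ℕ³ = ℕ × ℕ × ℕ

ℤ³ : Set
ℤ³ = ℤ × ℤ × ℤ

eval : ℕ → ℕ³ → ℕ
eval a (α₁ , α₂ , α₃) = α₁ * a + α₂ * (a + 1) + α₃ * (a + 2)

InF : ℕ → ℕ → ℕ³ → Set
InF a r α = eval a α ≡ r

InS : ℕ → ℕ → Set
InS a r = ∃ λ (α : ℕ³) → InF a r α

𝓛 : ℕ → ℕ
𝓛 a with a % 2
... | 0 = (a / 2) * (a + 2)
... | _ = (a / 2 + 2) * a

ω : ℤ³
ω = (ℤ.- + 1 , + 2 , ℤ.- + 1)

toℤ³ : ℕ³ → ℤ³
toℤ³ (x , y , z) = (+ x , + y , + z)

_+[_]_ : ℤ³ → ℤ → ℤ³ → ℤ³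
(u₁ , u₂ , u₃) +[ j ] (v₁ , v₂ , v₃) = (u₁ ℤ.+ j ℤ.* v₁ , u₂ ℤ.+ j ℤ.* v₂ , u₃ ℤ.+ j ℤ.* v₃)

c₁ c₂ c₃ : ℕ³ → ℕ
c₁ (x , _ , _) = x
c₂ (_ , y , _) = y
c₃ (_ , _ , z) = z

{-# OPTIONS --safe #-}
-- Write eval a α = s·a + t with s = α₁ + α₂ + α₃ and t = α₂ + 2α₃, so 0 ≤ t ≤ 2s.
-- If two factorizations of r had totals s < s', then t = (s' − s)·a + t' ≥ a, hence
-- a ≤ 2s and r ≥ (s + 1)·a ≥ 𝓛_a.  Below 𝓛_a all factorizations of r therefore share
-- s and t, and two points of ℕ³ with the same s and t differ by a multiple of
-- ω = (−1, 2, −1), the generator of the kernel of (s, t).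
module Submission where

open import Defs
open import Data.Nat using (ℕ; _+_; _*_; _<_; _≤_; _>_; _⊓_; _∸_; suc; _%_; _/_; s≤s)
open import Data.Nat.Properties
open import Data.Nat.DivMod using (m%n<n; m≡m%n+[m/n]*n)
open import Data.Integer as ℤ using (ℤ; +_)
import Data.Integer.Properties as ℤₚ
import Data.Integer.Tactic.RingSolver as ℤ-Solver
open import Data.Nat.Tactic.RingSolver using (solve-∀)
open import Data.Product using (_×_; _,_; ∃; ∃-syntax; proj₂; map)
open import Data.Sum using (inj₁; inj₂)
open import Function using (_∘_)
open import Relation.Nullary using (contradiction)
open import Relation.Binary using (tri<; tri≈; tri>)
open import Relation.Binary.PropositionalEquality
  using (_≡_; _≢_; refl; sym; trans; cong; subst; subst₂; cong₂; ≢-sym; module ≡-Reasoning)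

m<n⇒m*a+t≡n*a+u⇒a≤t : ∀ {m n a t u} → m < n → m * a + t ≡ n * a + u → a ≤ t
m<n⇒m*a+t≡n*a+u⇒a≤t {m} {_} {a} {t} {u} m<n eq with m≤n⇒∃[o]m+o≡n m<n
... | d , refl = subst (a ≤_) (sym t≡a+[d*a+u]) (m≤m+n a (d * a + u))
  where
  regroup : ∀ m d a u → (suc m + d) * a + u ≡ m * a + (a + (d * a + u))
  regroup = solve-∀
  t≡a+[d*a+u] : t ≡ a + (d * a + u)
  t≡a+[d*a+u] = +-cancelˡ-≡ (m * a) t _ (trans eq (regroup m d a u))

-- 𝓛_a = (⌈a/2⌉ + 1)·a, and a ≤ 2s gives ⌈a/2⌉ ≤ s.
𝓛≤suc[s]*a : ∀ a s → a ≤ 2 * s → 𝓛 a ≤ suc s * a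
𝓛≤suc[s]*a a s a≤2s with a % 2 | m%n<n a 2 | m≡m%n+[m/n]*n a 2
... | 0 | _ | a≡h*2 = begin
  a / 2 * (a + 2)             ≡⟨ cong (λ x → a / 2 * (x + 2)) a≡h*2 ⟩
  a / 2 * (a / 2 * 2 + 2)     ≡⟨ h*[h*2+2]≡[1+h]*[h*2] (a / 2) ⟩
  suc (a / 2) * (a / 2 * 2)   ≡⟨ cong (suc (a / 2) *_) (sym a≡h*2) ⟩
  suc (a / 2) * a             ≤⟨ *-monoˡ-≤ a (s≤s h≤s) ⟩
  suc s * a                   ∎
  where
  open ≤-Reasoning
  h*[h*2+2]≡[1+h]*[h*2] : ∀ h → h * (h * 2 + 2) ≡ suc h * (h * 2)
  h*[h*2+2]≡[1+h]*[h*2] = solve-∀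
  h≤s : a / 2 ≤ s
  h≤s = *-cancelʳ-≤ (a / 2) s 2 (subst₂ _≤_ a≡h*2 (*-comm 2 s) a≤2s)
... | 1 | _ | a≡1+h*2 = *-monoˡ-≤ a (subst (_≤ suc s) (+-comm 2 (a / 2)) (s≤s h<s))
  where
  h<s : a / 2 < s
  h<s = *-cancelʳ-< 2 (a / 2) s (subst₂ _≤_ a≡1+h*2 (*-comm 2 s) a≤2s)
... | suc (suc _) | s≤s (s≤s ()) | _

total weight : ℕ³ → ℕ
total α = c₁ α + c₂ α + c₃ α
weight α = c₂ α + 2 * c₃ α

eval≡total*a+weight : ∀ a α → eval a α ≡ total α * a + weight α
eval≡total*a+weight a (x₁ , x₂ , x₃) = regroup x₁ x₂ x₃ a
  where
  regroup : ∀ x₁ x₂ x₃ a →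
    x₁ * a + x₂ * (a + 1) + x₃ * (a + 2) ≡ (x₁ + x₂ + x₃) * a + (x₂ + 2 * x₃)
  regroup = solve-∀

weight≤2*total : ∀ α → weight α ≤ 2 * total α
weight≤2*total (x₁ , x₂ , x₃) = subst (x₂ + 2 * x₃ ≤_) (regroup x₁ x₂ x₃) (m≤m+n _ _)
  where
  regroup : ∀ x₁ x₂ x₃ → x₂ + 2 * x₃ + (2 * x₁ + x₂) ≡ 2 * (x₁ + x₂ + x₃)
  regroup = solve-∀

𝓛≤eval-of-smaller-total : ∀ a α γ → total α < total γ → eval a α ≡ eval a γ →
  𝓛 a ≤ eval a α
𝓛≤eval-of-smaller-total a α γ lt eq = begin
  𝓛 a                         ≤⟨ 𝓛≤suc[s]*a a (total α) (≤-trans a≤weight (weight≤2*total α)) ⟩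
  suc (total α) * a           ≡⟨ +-comm a (total α * a) ⟩
  total α * a + a             ≤⟨ +-monoʳ-≤ (total α * a) a≤weight ⟩
  total α * a + weight α      ≡⟨ eval≡total*a+weight a α ⟨
  eval a α                    ∎
  where
  open ≤-Reasoning
  a≤weight : a ≤ weight α
  a≤weight = m<n⇒m*a+t≡n*a+u⇒a≤t lt (begin-equality
    total α * a + weight α    ≡⟨ eval≡total*a+weight a α ⟨
    eval a α                  ≡⟨ eq ⟩
    eval a γ                  ≡⟨ eval≡total*a+weight a γ ⟩
    total γ * a + weight γ    ∎)

total-unique-below-𝓛 : ∀ a α γ → eval a α ≡ eval a γ → eval a α < 𝓛 a →
  total α ≡ total γ
total-unique-below-𝓛 a α γ eq eval<𝓛 with <-cmp (total α) (total γ)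
... | tri< lt _ _ = contradiction (𝓛≤eval-of-smaller-total a α γ lt eq) (<⇒≱ eval<𝓛)
... | tri≈ _ t≡ _ = t≡
... | tri> _ _ gt = contradiction (𝓛≤eval-of-smaller-total a γ α gt (sym eq))
                                  (<⇒≱ (subst (_< 𝓛 a) eq eval<𝓛))

weight-unique : ∀ a α γ → eval a α ≡ eval a γ → total α ≡ total γ →
  weight α ≡ weight γ
weight-unique a α γ eq t≡ = +-cancelˡ-≡ (total α * a) _ _ (begin
  total α * a + weight α      ≡⟨ eval≡total*a+weight a α ⟨
  eval a α                    ≡⟨ eq ⟩
  eval a γ                    ≡⟨ eval≡total*a+weight a γ ⟩
  total γ * a + weight γ      ≡⟨ cong (λ s → s * a + weight γ) t≡ ⟨
  total α * a + weight γ      ∎)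
  where open ≡-Reasoning

data ω-Shift : ℕ → ℕ³ → ℕ³ → Set where
  shift : ∀ x₁ x₂ x₃ k → ω-Shift k (x₁ + k , x₂ , x₃ + k) (x₁ , x₂ + 2 * k , x₃)

ω-Shift-intro : ∀ {x₁ x₂ x₃ y₁ y₂ y₃} k →
  x₁ ≡ y₁ + k → y₂ ≡ x₂ + 2 * k → x₃ ≡ y₃ + k → ω-Shift k (x₁ , x₂ , x₃) (y₁ , y₂ , y₃)
ω-Shift-intro {x₂ = x₂} {y₁ = y₁} {y₃ = y₃} k refl refl refl = shift y₁ x₂ y₃ k

ω-Shift-of-≤ : ∀ {α γ} → total α ≡ total γ → weight α ≡ weight γ → c₂ α ≤ c₂ γ →
  ∃[ k ] ω-Shift k α γ
ω-Shift-of-≤ {x₁ , x₂ , x₃} {y₁ , y₂ , y₃} t≡ w≡ x₂≤y₂ =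
  k , ω-Shift-intro k x₁≡y₁+k y₂≡x₂+2*k x₃≡y₃+k
  where
  y₃≤x₃ : y₃ ≤ x₃
  y₃≤x₃ = ≮⇒≥ (λ x₃<y₃ → <⇒≢ (+-mono-≤-< x₂≤y₂ (*-monoʳ-< 2 x₃<y₃)) w≡)
  k : ℕ
  k = x₃ ∸ y₃
  x₃≡y₃+k : x₃ ≡ y₃ + k
  x₃≡y₃+k = sym (m+[n∸m]≡n y₃≤x₃)
  y₂≡x₂+2*k : y₂ ≡ x₂ + 2 * k
  y₂≡x₂+2*k = +-cancelʳ-≡ (2 * y₃) y₂ _ (begin
    y₂ + 2 * y₃               ≡⟨ w≡ ⟨
    x₂ + 2 * x₃               ≡⟨ cong (λ z → x₂ + 2 * z) x₃≡y₃+k ⟩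
    x₂ + 2 * (y₃ + k)         ≡⟨ regroup x₂ y₃ k ⟩
    x₂ + 2 * k + 2 * y₃       ∎)
    where
    open ≡-Reasoning
    regroup : ∀ x₂ y₃ k → x₂ + 2 * (y₃ + k) ≡ x₂ + 2 * k + 2 * y₃
    regroup = solve-∀
  x₁≡y₁+k : x₁ ≡ y₁ + k
  x₁≡y₁+k = +-cancelʳ-≡ (x₂ + y₃ + k) x₁ _ (begin
    x₁ + (x₂ + y₃ + k)        ≡⟨ regroupˡ x₁ x₂ y₃ k ⟩
    x₁ + x₂ + (y₃ + k)        ≡⟨ cong (_+_ (x₁ + x₂)) x₃≡y₃+k ⟨
    x₁ + x₂ + x₃              ≡⟨ t≡ ⟩
    y₁ + y₂ + y₃              ≡⟨ cong (λ z → y₁ + z + y₃) y₂≡x₂+2*k ⟩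
    y₁ + (x₂ + 2 * k) + y₃    ≡⟨ regroupʳ y₁ x₂ y₃ k ⟩
    y₁ + k + (x₂ + y₃ + k)    ∎)
    where
    open ≡-Reasoning
    regroupˡ : ∀ x₁ x₂ y₃ k → x₁ + (x₂ + y₃ + k) ≡ x₁ + x₂ + (y₃ + k)
    regroupˡ = solve-∀
    regroupʳ : ∀ y₁ x₂ y₃ k → y₁ + (x₂ + 2 * k) + y₃ ≡ y₁ + k + (x₂ + y₃ + k)
    regroupʳ = solve-∀

ω-Shift-by-0⇒≡ : ∀ {k α γ} → ω-Shift k α γ → k ≡ 0 → α ≡ γ
ω-Shift-by-0⇒≡ (shift x₁ x₂ x₃ _) refl
  rewrite +-identityʳ x₁ | +-identityʳ x₂ | +-identityʳ x₃ = refl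

ω-Shift-moves-every-coordinate : ∀ {k α γ} → ω-Shift k α γ → α ≢ γ →
  c₁ α ≢ c₁ γ × c₂ α ≢ c₂ γ × c₃ α ≢ c₃ γ
ω-Shift-moves-every-coordinate s@(shift x₁ x₂ x₃ k) α≢γ =
  (λ e → α≢γ (ω-Shift-by-0⇒≡ s (m+n≡m⇒n≡0 x₁ e))) ,
  (λ e → α≢γ (ω-Shift-by-0⇒≡ s (m+n≡0⇒m≡0 k (m+n≡m⇒n≡0 x₂ (sym e))))) ,
  (λ e → α≢γ (ω-Shift-by-0⇒≡ s (m+n≡m⇒n≡0 x₃ e)))
  where
  m+n≡m⇒n≡0 : ∀ m {n} → m + n ≡ m → n ≡ 0
  m+n≡m⇒n≡0 m {n} eq = +-cancelˡ-≡ m n 0 (trans eq (sym (+-identityʳ m)))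

ω-Shift⇒≤⊓ : ∀ {k α γ} → ω-Shift k α γ → k ≤ c₁ α ⊓ c₃ α
ω-Shift⇒≤⊓ (shift x₁ _ x₃ k) = ⊓-glb (m≤n+m k x₁) (m≤n+m k x₃)

ω-Shift⇒toℤ³ : ∀ {k α γ} → ω-Shift k α γ → toℤ³ γ ≡ toℤ³ α +[ + k ] ω
ω-Shift⇒toℤ³ (shift x₁ x₂ x₃ k) =
  cong₂ _,_ (+m≡+[m+k]-k x₁) (cong₂ _,_ +[m+2*k]≡+m+k*2 (+m≡+[m+k]-k x₃))
  where
  open ≡-Reasoning
  +m≡+[m+k]-k : ∀ m → + m ≡ + (m + k) ℤ.+ + k ℤ.* ℤ.- + 1
  +m≡+[m+k]-k m = begin
    + m                                     ≡⟨ cancel (+ m) (+ k) ⟩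
    (+ m ℤ.+ + k) ℤ.+ + k ℤ.* ℤ.- + 1       ≡⟨ cong (ℤ._+ + k ℤ.* ℤ.- + 1) (ℤₚ.pos-+ m k) ⟨
    + (m + k) ℤ.+ + k ℤ.* ℤ.- + 1           ∎
    where
    cancel : ∀ x y → x ≡ (x ℤ.+ y) ℤ.+ y ℤ.* ℤ.- + 1
    cancel = ℤ-Solver.solve-∀
  +[m+2*k]≡+m+k*2 : + (x₂ + 2 * k) ≡ + x₂ ℤ.+ + k ℤ.* + 2
  +[m+2*k]≡+m+k*2 = begin
    + (x₂ + 2 * k)                          ≡⟨ ℤₚ.pos-+ x₂ (2 * k) ⟩
    + x₂ ℤ.+ + (2 * k)                      ≡⟨ cong (ℤ._+_ (+ x₂)) (ℤₚ.pos-* 2 k) ⟩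
    + x₂ ℤ.+ + 2 ℤ.* + k                    ≡⟨ cong (ℤ._+_ (+ x₂)) (ℤₚ.*-comm (+ 2) (+ k)) ⟩
    + x₂ ℤ.+ + k ℤ.* + 2                    ∎

ω-Shift⇒translate : ∀ {k α γ} → ω-Shift k α γ → α ≢ γ →
  ∃ λ (j : ℤ) → (+ 1 ℤ.≤ j) × (j ℤ.≤ + (c₁ α ⊓ c₃ α)) × (toℤ³ γ ≡ toℤ³ α +[ j ] ω)
ω-Shift⇒translate s α≢γ =
  _ , ℤ.+≤+ (n≢0⇒n>0 (α≢γ ∘ ω-Shift-by-0⇒≡ s)) , ℤ.+≤+ (ω-Shift⇒≤⊓ s) , ω-Shift⇒toℤ³ s

proposition2p6 : (a : ℕ) → 3 ≤ a → (r : ℕ) → InS a r → r < 𝓛 a →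
  (α γ : ℕ³) → InF a r α → InF a r γ → α ≢ γ →
  (c₁ α + c₂ α + c₃ α ≡ c₁ γ + c₂ γ + c₃ γ)
  × (c₂ α + 2 * c₃ α ≡ c₂ γ + 2 * c₃ γ)
  × (c₁ α ≢ c₁ γ × c₂ α ≢ c₂ γ × c₃ α ≢ c₃ γ)
  × ((c₂ γ > c₂ α → ∃ λ (j : ℤ) → (+ 1 ℤ.≤ j) × (j ℤ.≤ + (c₁ α ⊓ c₃ α))
        × (toℤ³ γ ≡ toℤ³ α +[ j ] ω))
    × (c₂ γ < c₂ α → ∃ λ (j : ℤ) → (+ 1 ℤ.≤ j) × (j ℤ.≤ + (c₁ γ ⊓ c₃ γ))
        × (toℤ³ α ≡ toℤ³ γ +[ j ] ω)))
proposition2p6 a _ r _ r<𝓛 α γ α∈F γ∈F α≢γ =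
  total≡ , weight≡ , coordinates≢ ,
  (λ c₂α<c₂γ → ω-Shift⇒translate (proj₂ (shift-up (<⇒≤ c₂α<c₂γ))) α≢γ) ,
  (λ c₂γ<c₂α → ω-Shift⇒translate (proj₂ (shift-down (<⇒≤ c₂γ<c₂α))) (≢-sym α≢γ))
  where
  eval≡ : eval a α ≡ eval a γ
  eval≡ = trans α∈F (sym γ∈F)
  total≡ : total α ≡ total γ
  total≡ = total-unique-below-𝓛 a α γ eval≡ (subst (_< 𝓛 a) (sym α∈F) r<𝓛)
  weight≡ : weight α ≡ weight γ
  weight≡ = weight-unique a α γ eval≡ total≡
  shift-up : c₂ α ≤ c₂ γ → ∃[ k ] ω-Shift k α γ
  shift-up = ω-Shift-of-≤ total≡ weight≡
  shift-down : c₂ γ ≤ c₂ α → ∃[ k ] ω-Shift k γ α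
  shift-down = ω-Shift-of-≤ (sym total≡) (sym weight≡)
  coordinates≢ : c₁ α ≢ c₁ γ × c₂ α ≢ c₂ γ × c₃ α ≢ c₃ γ
  coordinates≢ with ≤-total (c₂ α) (c₂ γ)
  ... | inj₁ c₂α≤c₂γ = ω-Shift-moves-every-coordinate (proj₂ (shift-up c₂α≤c₂γ)) α≢γ
  ... | inj₂ c₂γ≤c₂α = map ≢-sym (map ≢-sym ≢-sym)
    (ω-Shift-moves-every-coordinate (proj₂ (shift-down c₂γ≤c₂α)) (≢-sym α≢γ))
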